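{- Let $n$ be a positive integer with $\gcd(n,6)=1$. If $k\ge 2$ is good, then $k/2$ is good.
   Context: $[\cdot]$ is the floor function. An integer $k$ is called good (relative to $n$) if: (i) $k=2^l$ for some integer $l\ge0$; (ii) $k<\frac{n}{6}$; (iii) $F(k):=\left(2n-2-2\left[\frac{3k-1}{3k}n\right]\right)k>\frac{n-1}{2}$. -}

module Defs where

open import Data.Nat using (ℕ; zero; suc; _+_; _*_; _∸_; _^_; _<_)
open import Data.Nat.DivMod using (_/_)
open import Data.Product using (Σ; _×_)
open import Relation.Binary.PropositionalEquality using (_≡_)

-- ⌊ ((3k-1)/(3k)) · n ⌋ ; only used for k ≥ 1 (k = 2^l), the k = 0 clause is a dummy.
flr : ℕ → ℕ → ℕ
flr n zero    = 0
flr n (suc m) = ((3 * suc m ∸ 1) * n) / (3 * suc m)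

-- F(k) = (2n - 2 - 2⌊(3k-1)n/(3k)⌋) k.  For n ≥ 1, k ≥ 1 the floor is ≤ n-1,
-- so the truncated subtraction agrees with integer subtraction.
F : ℕ → ℕ → ℕ
F n k = (2 * n ∸ 2 ∸ 2 * flr n k) * k

-- k good relative to n:
--  (i) k = 2^l, (ii) k < n/6  ⇔ 6k < n, (iii) F(k) > (n-1)/2 ⇔ 2F(k) > n-1.
Good : ℕ → ℕ → Set
Good n k = Σ ℕ (λ l → k ≡ 2 ^ l) × (6 * k < n) × (n ∸ 1 < 2 * F n k)

module Submission where

-- For m ≥ 1 the number  n ∸ ⌊(m-1)n/m⌋  is exactly the ceiling
-- ⌈n/m⌉, i.e. the unique c with (c-1)m < n ≤ cm.  Hence, writing m = 3k,
--     F(k) = 2 (⌈n/(3k)⌉ - 1) k .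
-- Ceilings halve at least as fast as their divisor doubles:
--     2 (⌈n/(2m)⌉ - 1) ≤ ⌈n/m⌉ - 1 ,
-- because (⌈n/(2m)⌉ - 1)·2m < n ≤ ⌈n/m⌉·m.  Multiplying by k = 2j gives
-- F(2j) ≤ F(j), so condition (iii) passes from k to k/2; conditions (i)
-- and (ii) pass from k to k/2 trivially (2^(l+1)/2 = 2^l, and k/2 < k).

open import Defs
open import Data.Nat using (ℕ; zero; suc; _+_; _*_; _∸_; _^_; _≤_; _<_; z≤n; s≤s)
open import Data.Nat.GCD using (gcd)
open import Data.Nat.DivMod using (_/_; _%_; m≡m%n+[m/n]*n; m%n<n)
open import Data.Nat.Properties
open import Data.Product using (Σ; _×_; _,_)
open import Relation.Binary.PropositionalEquality
open import Data.Nat.Solver using (module +-*-Solver)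
open +-*-Solver using (solve; _:*_; _:=_; con)

IsCeilDiv : ℕ → ℕ → ℕ → Set
IsCeilDiv n m c = (c ∸ 1) * m < n × n ≤ c * m

m<n⇒m≤n∸1 : ∀ {m n} → m < n → m ≤ n ∸ 1
m<n⇒m≤n∸1 (s≤s m≤n-1) = m≤n-1

-- For m = p + 1 and n ≥ 1, the complement  n ∸ ⌊p·n/m⌋  of the floor is ⌈n/m⌉.
-- Everything follows from the division identity  r + n = (n ∸ ⌊p·n/m⌋)·m,
-- where r = p·n mod m < m.
complement-floor-isCeil : (p n : ℕ) → 0 < n →
                          IsCeilDiv n (suc p) (n ∸ (p * n) / suc p)
complement-floor-isCeil p n 0<n = lower , upper
  where
  m a r b : ℕ
  m = suc p
  a = (p * n) / m
  r = (p * n) % m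
  b = n ∸ a

  division : p * n ≡ r + a * m
  division = m≡m%n+[m/n]*n (p * n) m

  a≤n : a ≤ n
  a≤n = *-cancelʳ-≤ a n m (begin
      a * m      ≤⟨ m≤n+m (a * m) r ⟩
      r + a * m  ≡⟨ division ⟨
      p * n      ≤⟨ m≤n+m (p * n) n ⟩
      m * n      ≡⟨ *-comm m n ⟩
      n * m      ∎)
    where open ≤-Reasoning

  remainder+n : r + n ≡ b * m
  remainder+n = +-cancelˡ-≡ (a * m) (r + n) (b * m) (begin
      a * m + (r + n)  ≡⟨ +-assoc (a * m) r n ⟨
      a * m + r + n    ≡⟨ cong (_+ n) (+-comm (a * m) r) ⟩
      r + a * m + n    ≡⟨ cong (_+ n) division ⟨
      p * n + n        ≡⟨ +-comm (p * n) n ⟩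
      m * n            ≡⟨ *-comm m n ⟩
      n * m            ≡⟨ cong (_* m) (m+[n∸m]≡n a≤n) ⟨
      (a + b) * m      ≡⟨ *-distribʳ-+ m a b ⟩
      a * m + b * m    ∎)
    where open ≡-Reasoning

  upper : n ≤ b * m
  upper = subst (n ≤_) remainder+n (m≤n+m n r)

  lowerFor : (c : ℕ) → c ≡ b → (c ∸ 1) * m < n
  lowerFor zero    _   = 0<n
  lowerFor (suc c) c≡b = +-cancelˡ-< m (c * m) n (begin-strict
      m + c * m  ≡⟨ cong (_* m) c≡b ⟩
      b * m      ≡⟨ remainder+n ⟨
      r + n      <⟨ +-monoˡ-< n (m%n<n (p * n) m) ⟩
      m + n      ∎)
    where open ≤-Reasoning

  lower : (b ∸ 1) * m < n
  lower = lowerFor b refl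

-- Doubling the divisor at least halves the ceiling (after subtracting one):
-- (c - 1)·2m < n ≤ d·m  forces  2(c - 1) < d.
ceil-halving : ∀ {n m c d} → IsCeilDiv n (2 * m) c → IsCeilDiv n m d →
               2 * (c ∸ 1) ≤ d ∸ 1
ceil-halving {n} {m} {c} {d} (c-lower , _) (_ , d-upper) =
  m<n⇒m≤n∸1 (*-cancelʳ-< m (2 * (c ∸ 1)) d (begin-strict
      2 * (c ∸ 1) * m  ≡⟨ solve 2 (λ x y → con 2 :* x :* y := x :* (con 2 :* y))
                                 refl (c ∸ 1) m ⟩
      (c ∸ 1) * (2 * m) <⟨ c-lower ⟩
      n                 ≤⟨ d-upper ⟩
      d * m             ∎))
  where open ≤-Reasoning

double-slack : ∀ n a → 2 * n ∸ 2 ∸ 2 * a ≡ 2 * (n ∸ a ∸ 1)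
double-slack n a = begin
    2 * n ∸ 2 ∸ 2 * a    ≡⟨ ∸-+-assoc (2 * n) 2 (2 * a) ⟩
    2 * n ∸ (2 + 2 * a)  ≡⟨ cong (2 * n ∸_) (+-comm 2 (2 * a)) ⟩
    2 * n ∸ (2 * a + 2)  ≡⟨ ∸-+-assoc (2 * n) (2 * a) 2 ⟨
    2 * n ∸ 2 * a ∸ 2    ≡⟨ cong (_∸ 2) (*-distribˡ-∸ 2 n a) ⟨
    2 * (n ∸ a) ∸ 2 * 1  ≡⟨ *-distribˡ-∸ 2 (n ∸ a) 1 ⟨
    2 * (n ∸ a ∸ 1)      ∎
  where open ≡-Reasoning

F-via-slack : ∀ n k → F n k ≡ 2 * (n ∸ flr n k ∸ 1) * k
F-via-slack n k = cong (_* k) (double-slack n (flr n k))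

slack-isCeil : ∀ n k → 0 < k → 0 < n → IsCeilDiv n (3 * k) (n ∸ flr n k)
slack-isCeil n (suc i) _ 0<n = complement-floor-isCeil (3 * suc i ∸ 1) n 0<n

half-power-of-two : ∀ j l → 0 < j → 2 * j ≡ 2 ^ l → Σ ℕ (λ l′ → j ≡ 2 ^ l′)
half-power-of-two j zero    0<j 2j≡1 with subst (2 ≤_) 2j≡1 (*-monoʳ-≤ 2 0<j)
... | s≤s ()
half-power-of-two j (suc l) _   2j≡2^[1+l] = l , *-cancelˡ-≡ j (2 ^ l) 2 2j≡2^[1+l]

F-double-≤ : ∀ n j → 0 < n → F n (2 * suc j) ≤ F n (suc j)
F-double-≤ n j 0<n = begin
    F n k                               ≡⟨ F-via-slack n k ⟩
    2 * (c ∸ 1) * (2 * suc j)           ≡⟨ solve 2 (λ x y → con 2 :* x :* (con 2 :* y)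
                                                     := con 2 :* (con 2 :* x) :* y)
                                                refl (c ∸ 1) (suc j) ⟩
    2 * (2 * (c ∸ 1)) * suc j           ≤⟨ *-monoˡ-≤ (suc j) (*-monoʳ-≤ 2 halved) ⟩
    2 * (d ∸ 1) * suc j                 ≡⟨ F-via-slack n (suc j) ⟨
    F n (suc j)                         ∎
  where
  open ≤-Reasoning
  k : ℕ
  k = 2 * suc j
  c d : ℕ
  c = n ∸ flr n k
  d = n ∸ flr n (suc j)
  three-times-double : 3 * k ≡ 2 * (3 * suc j)
  three-times-double = solve 1 (λ x → con 3 :* (con 2 :* x) := con 2 :* (con 3 :* x))
                             refl (suc j)
  halved : 2 * (c ∸ 1) ≤ d ∸ 1
  halved = ceil-halving {n} {3 * suc j} {c} {d}
             (subst (λ m → IsCeilDiv n m c) three-times-double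
                    (slack-isCeil n k (s≤s z≤n) 0<n))
             (slack-isCeil n (suc j) (s≤s z≤n) 0<n)

lemma4 : (n : ℕ) → 0 < n → gcd n 6 ≡ 1 →
    (k : ℕ) → 2 ≤ k → Good n k →
    (j : ℕ) → k ≡ 2 * j → Good n j
-- j = 0 is ruled out by k ≥ 2; otherwise (i)–(iii) pass from k = 2j to j.
lemma4 n 0<n _ .0 () _ zero refl
lemma4 n 0<n _ k _ ((l , k≡2^l) , 6k<n , hF) (suc j) refl =
  (half-power-of-two (suc j) l (s≤s z≤n) k≡2^l , six-j<n , F-bound)
  where
  six-j<n : 6 * suc j < n
  six-j<n = ≤-<-trans (*-monoʳ-≤ 6 (m≤m+n (suc j) (suc j + 0))) 6k<n
  F-bound : n ∸ 1 < 2 * F n (suc j)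
  F-bound = <-≤-trans hF (*-monoʳ-≤ 2 (F-double-≤ n j 0<n))
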